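{- For every $n\geq 4$, the wheel $W_n$ has no interval total $t$-coloring with $t\geq n+5$; that is, $W_\tau(W_n)\leq n+4$.
   Context: All graphs are finite, undirected, without loops or multiple edges. For $n\geq 4$ the wheel $W_n$ has vertex set $\{u,v_1,\ldots,v_{n-1}\}$ and edge set $\{uv_i:1\leq i\leq n-1\}\cup\{v_iv_{i+1}:1\leq i\leq n-2\}\cup\{v_1v_{n-1}\}$. A total coloring of a graph $G$ is an assignment of colors to the vertices and edges of $G$ such that no two adjacent vertices, no two adjacent edges, and no vertex and an edge incident to it receive the same color. For a positive integer $t$, an interval total $t$-coloring of $G$ is a total coloring of $G$ with colors $1,2,\ldots,t$ such that each color $i\in\{1,\ldots,t\}$ is used on at least one vertex or edge, and for each vertex $v$ the set consisting of the color of $v$ and the colors of the edges incident to $v$ consists of $d_G(v)+1$ consecutive integers, where $d_G(v)$ is the degree of $v$. For a graph $G$ having some interval total coloring, $W_\tau(G)$ is the greatest $t$ for which $G$ has an interval total $t$-coloring. -}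

module Defs where

open import Data.Nat using (ℕ; zero; suc; _+_; _∸_; _≤_; _≡ᵇ_)
open import Data.Bool using (Bool; true; false; _∧_; _∨_; not; if_then_else_)
open import Data.Fin using (Fin; toℕ)
open import Data.Product using (Σ; ∃; _×_; _,_)
open import Data.Sum using (_⊎_)
open import Relation.Binary.PropositionalEquality using (_≡_; _≢_)
open import Relation.Nullary using (¬_)

-- A finite simple graph on vertex set Fin V, given by a Boolean adjacency
-- function (symmetric and irreflexive for the graphs we use).
record Graph : Set where
  field
    V   : ℕ
    adj : Fin V → Fin V → Bool

open Graph public

countℕ : (m : ℕ) → (Fin m → Bool) → ℕ
countℕ zero    p = 0
countℕ (suc m) p = (if p Fin.zero then 1 else 0) + countℕ m (λ i → p (Fin.suc i))

deg : (G : Graph) → Fin (V G) → ℕ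
deg G v = countℕ (V G) (adj G v)

-- Wheel W_n: vertex 0 is the hub u, vertex i (1 ≤ i ≤ n-1) is v_i.
-- Adjacency on natural-number labels:
--   u ~ v_i for all i;  v_i ~ v_{i+1} (1 ≤ i ≤ n-2);  v_1 ~ v_{n-1}.
wheelAdjℕ : ℕ → ℕ → ℕ → Bool
wheelAdjℕ n zero    zero    = false
wheelAdjℕ n zero    (suc b) = true
wheelAdjℕ n (suc a) zero    = true
wheelAdjℕ n (suc a) (suc b) =
  (suc b ≡ᵇ suc (suc a)) ∨ (suc a ≡ᵇ suc (suc b))
  ∨ ((suc a ≡ᵇ 1) ∧ (suc b ≡ᵇ n ∸ 1)) ∨ ((suc b ≡ᵇ 1) ∧ (suc a ≡ᵇ n ∸ 1))

wheel : ℕ → Graph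
wheel n = record { V = n ; adj = λ x y → wheelAdjℕ n (toℕ x) (toℕ y) }

-- A total coloring: vertex colors c and edge colors f (f x y is the color of
-- the edge xy, only meaningful when x ~ y; required symmetric on edges).
record IntervalTotalColoring (G : Graph) (t : ℕ) : Set where
  field
    c : Fin (V G) → ℕ
    f : Fin (V G) → Fin (V G) → ℕ
    f-sym : ∀ x y → adj G x y ≡ true → f x y ≡ f y x
    c-range : ∀ x → 1 ≤ c x × c x ≤ t
    f-range : ∀ x y → adj G x y ≡ true → 1 ≤ f x y × f x y ≤ t
    vv-proper : ∀ x y → adj G x y ≡ true → c x ≢ c y
    ee-proper : ∀ x y z → adj G x y ≡ true → adj G x z ≡ true → y ≢ z → f x y ≢ f x z
    ve-proper : ∀ x y → adj G x y ≡ true → c x ≢ f x y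
    surj : ∀ i → 1 ≤ i → i ≤ t →
           (∃ λ x → c x ≡ i) ⊎ (∃ λ x → ∃ λ y → adj G x y ≡ true × f x y ≡ i)
    interval : ∀ v → ∃ λ a → ∀ k →
      ((k ≡ c v ⊎ (∃ λ w → adj G v w ≡ true × f v w ≡ k)) → a ≤ k × k ≤ a + deg G v)
      × (a ≤ k × k ≤ a + deg G v → (k ≡ c v ⊎ (∃ λ w → adj G v w ≡ true × f v w ≡ k)))

module Submission where

open import Defs
open import Data.Nat using (ℕ; zero; suc; _+_; _*_; _∸_; _≤_; _<_; _≤?_; _<?_; z≤n; s≤s; s≤s⁻¹; _≡ᵇ_; NonZero)
open import Data.Nat.Properties
open import Data.Nat.DivMod using (_%_; _/_; _mod_; m≡m%n+[m/n]*n; [m+n]%n≡m%n; [m+kn]%n≡m%n; m%n%n≡m%n; %-distribˡ-+; m%n<n; m<n⇒m%n≡m; n%n≡0)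
open import Algebra.Properties.CommutativeSemigroup +-commutativeSemigroup using (xy∙z≈xz∙y)
open import Data.Bool using (Bool; true; false; T; _∨_; _∧_)
open import Data.Bool.Properties using (T-≡; T-∨; T-∧; ∨-assoc; ∨-comm)
open import Data.Fin using (Fin; toℕ) renaming (zero to fzero; suc to fsuc)
open import Data.Fin.Properties using (toℕ<n; toℕ-fromℕ<; fromℕ<-cong; fromℕ<-toℕ) renaming (_≟_ to _≟ᶠ_; suc-injective to fsuc-injective)
open import Data.Product using (∃; _×_; _,_; proj₁; proj₂)
open import Data.Sum using (_⊎_; inj₁; inj₂)
open import Data.Empty using (⊥; ⊥-elim)
open import Function.Bundles using (Equivalence)
open import Relation.Binary.PropositionalEquality
open import Relation.Nullary using (¬_; yes; no)

-- Let m = n - 1 be the number of rim vertices and [a, a + m] the colours at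
-- the hub.  Each rim vertex sees exactly four colours, a window
-- [s, s + 3] containing its spoke colour.  If the smallest spoke colour a is the
-- top of its window, then walking round the rim from that spoke in order of
-- increasing spoke colour shows that every spoke is the top of its window, so
-- no colour exceeds a + m; dually (reflecting the colours) if the largest spoke
-- colour a + m is the bottom of its window, no colour is below a.  Where the
-- colours 1 and t >= m + 6 occur forces one of these two situations together
-- with a bound on a that contradicts it.

InWindow : ℕ → ℕ → Set
InWindow s x = s ≤ x × x ≤ 3 + s

SpokeOnTop : (S H : ℕ → ℕ) → ℕ → Set
SpokeOnTop S H k = 3 + S k ≡ H k

Periodic : ℕ → (ℕ → ℕ) → Set
Periodic m h = ∀ k → h (k + m) ≡ h k

module _ {m : ℕ} .{{_ : NonZero m}} {h : ℕ → ℕ} (periodic : Periodic m h) where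

  periodic-+* : ∀ j k → h (k + j * m) ≡ h k
  periodic-+* zero    k = cong h (+-identityʳ k)
  periodic-+* (suc j) k = begin
    h (k + (m + j * m))  ≡⟨ cong h (trans (cong (k +_) (+-comm m (j * m))) (sym (+-assoc k (j * m) m))) ⟩
    h (k + j * m + m)    ≡⟨ periodic (k + j * m) ⟩
    h (k + j * m)        ≡⟨ periodic-+* j k ⟩
    h k                  ∎
    where open ≡-Reasoning

  periodic-% : ∀ {k l} → k % m ≡ l % m → h k ≡ h l
  periodic-% {k} {l} k≡l = begin
    h k                        ≡⟨ cong h (m≡m%n+[m/n]*n k m) ⟩
    h (k % m + (k / m) * m)    ≡⟨ periodic-+* (k / m) (k % m) ⟩
    h (k % m)                  ≡⟨ cong h k≡l ⟩
    h (l % m)                  ≡⟨ periodic-+* (l / m) (l % m) ⟨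
    h (l % m + (l / m) * m)    ≡⟨ cong h (m≡m%n+[m/n]*n l m) ⟨
    h l                        ∎
    where open ≡-Reasoning

%-cancelʳ-+ : ∀ {m} .{{_ : NonZero m}} k l v → (k + v) % m ≡ (l + v) % m → k % m ≡ l % m
%-cancelʳ-+ {m@(suc p)} k l v k+v≡l+v = begin
  k % m                                ≡⟨ [m+kn]%n≡m%n k v m ⟨
  (k + v * m) % m                      ≡⟨ cong (_% m) (regroup k) ⟩
  (k + v + v * p) % m                  ≡⟨ %-distribˡ-+ (k + v) (v * p) m ⟩
  ((k + v) % m + (v * p) % m) % m      ≡⟨ cong (λ r → (r + (v * p) % m) % m) k+v≡l+v ⟩
  ((l + v) % m + (v * p) % m) % m      ≡⟨ %-distribˡ-+ (l + v) (v * p) m ⟨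
  (l + v + v * p) % m                  ≡⟨ cong (_% m) (regroup l) ⟨
  (l + v * m) % m                      ≡⟨ [m+kn]%n≡m%n l v m ⟩
  l % m                                ∎
  where
  open ≡-Reasoning
  regroup : ∀ x → x + v * m ≡ x + v + v * p
  regroup x = trans (cong (x +_) (*-suc v p)) (sym (+-assoc x v (v * p)))

squeeze : ∀ {h e s h'} → e < h → s ≤ e → h' ≤ 3 + s → 2 + h ≤ h' → 3 + s ≡ h' × h' ≡ 2 + h
squeeze e<h s≤e h'≤ h'≥ = ≤-antisym (≤-trans top h'≥) h'≤ , ≤-antisym (≤-trans h'≤ top) h'≥
  where
  top = ≤-trans (+-monoʳ-≤ 3 s≤e) (+-monoʳ-≤ 2 e<h)

-- At a rim vertex whose spoke a is on top of its window, the two rim edges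
-- have distinct colours below a; this pins the neighbouring spokes to a + 1
-- and a + 2, both on top of their windows.
anchor-neighbours : ∀ {a e e' s s' h h'} → e < a → e' < a → e ≢ e' →
  s ≤ e → h ≤ 3 + s → s' ≤ e' → h' ≤ 3 + s' → 2 + a ≤ h → suc a ≤ h' →
  (3 + s ≡ h × h ≡ 2 + a) × (3 + s' ≡ h' × h' ≡ suc a)
anchor-neighbours {a} {e} {e'} {s} {s'} {h} {h'} e<a e'<a e≢e' s≤e h≤ s'≤e' h'≤ h≥ h'≥ =
  (top , h≡) , (proj₁ second , trans (proj₂ second) (cong suc 1+e≡a))
  where
  first : 3 + s ≡ h × h ≡ 2 + a
  first = squeeze e<a s≤e h≤ h≥
  top : 3 + s ≡ h
  top = proj₁ first
  h≡ : h ≡ 2 + a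
  h≡ = proj₂ first
  1+e≡a : suc e ≡ a
  1+e≡a = ≤-antisym e<a (+-cancelˡ-≤ 2 a (suc e)
            (≤-trans (≤-reflexive (sym (trans top h≡))) (+-monoʳ-≤ 3 s≤e)))
  e'<e : e' < e
  e'<e = ≤∧≢⇒< (s≤s⁻¹ (subst (suc e' ≤_) (sym 1+e≡a) e'<a)) (λ eq → e≢e' (sym eq))
  second : 3 + s' ≡ h' × h' ≡ 2 + e
  second = squeeze e'<e s'≤e' h'≤ (subst (_≤ h') (cong suc (sym 1+e≡a)) h'≥)

3+[n∸[3+m]]≡n∸m : ∀ m n → 3 + m ≤ n → 3 + (n ∸ (3 + m)) ≡ n ∸ m
3+[n∸[3+m]]≡n∸m zero    n       le       = m+[n∸m]≡n le
3+[n∸[3+m]]≡n∸m (suc m) (suc n) (s≤s le) = 3+[n∸[3+m]]≡n∸m m n le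

-- Colours of the rim of a wheel with m rim vertices, read round the rim:
-- H k is the spoke at rim vertex k, S k the start of its window of colours,
-- and E k the rim edge from vertex k to vertex k + 1.
record CyclicPattern (m : ℕ) .{{_ : NonZero m}} (a A : ℕ) (H S E : ℕ → ℕ) : Set where
  field
    spoke∈window     : ∀ k → InWindow (S k) (H k)
    edge∈window      : ∀ k → InWindow (S k) (E k)
    edge∈next-window : ∀ k → InWindow (S (suc k)) (E k)
    edge≢spoke       : ∀ k → E k ≢ H k
    edge≢next-spoke  : ∀ k → E k ≢ H (suc k)
    edge≢next-edge   : ∀ k → E k ≢ E (suc k)
    spoke-injective  : ∀ k l → H k ≡ H l → k % m ≡ l % m
    spoke-bounds     : ∀ k → a ≤ H k × H k ≤ A
    H-periodic       : Periodic m H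
    S-periodic       : Periodic m S
    E-periodic       : Periodic m E

module _ {m a A : ℕ} .{{_ : NonZero m}} {H S E : ℕ → ℕ} (P : CyclicPattern m a A H S E) where
  open CyclicPattern P

  spoke-on-top-% : ∀ {k l} → k % m ≡ l % m → SpokeOnTop S H k → SpokeOnTop S H l
  spoke-on-top-% k≡l top = trans (cong (3 +_) (periodic-% S-periodic (sym k≡l)))
                                 (trans top (periodic-% H-periodic k≡l))

  rotate : ∀ v → CyclicPattern m a A (λ k → H (k + v)) (λ k → S (k + v)) (λ k → E (k + v))
  rotate v = record
    { spoke∈window     = λ k → spoke∈window (k + v)
    ; edge∈window      = λ k → edge∈window (k + v)
    ; edge∈next-window = λ k → edge∈next-window (k + v)
    ; edge≢spoke       = λ k → edge≢spoke (k + v)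
    ; edge≢next-spoke  = λ k → edge≢next-spoke (k + v)
    ; edge≢next-edge   = λ k → edge≢next-edge (k + v)
    ; spoke-injective  = λ k l eq → %-cancelʳ-+ k l v (spoke-injective (k + v) (l + v) eq)
    ; spoke-bounds     = λ k → spoke-bounds (k + v)
    ; H-periodic       = shifted H-periodic
    ; S-periodic       = shifted S-periodic
    ; E-periodic       = shifted E-periodic
    }
    where
    shifted : ∀ {h} → Periodic m h → Periodic m (λ k → h (k + v))
    shifted {h} periodic k = trans (cong h (xy∙z≈xz∙y k m v)) (periodic (k + v))

  reflect : let N = 3 + A in
    CyclicPattern m (N ∸ A) (N ∸ a) (λ k → N ∸ H k) (λ k → N ∸ (3 + S k)) (λ k → N ∸ E k)
  reflect = record
    { spoke∈window     = λ k → reflect-window (spoke∈window k) (window≤N k)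
    ; edge∈window      = λ k → reflect-window (edge∈window k) (window≤N k)
    ; edge∈next-window = λ k → reflect-window (edge∈next-window k) (window≤N (suc k))
    ; edge≢spoke       = λ k → reflect-≢ (edge≤N k) (spoke≤N k) (edge≢spoke k)
    ; edge≢next-spoke  = λ k → reflect-≢ (edge≤N k) (spoke≤N (suc k)) (edge≢next-spoke k)
    ; edge≢next-edge   = λ k → reflect-≢ (edge≤N k) (edge≤N (suc k)) (edge≢next-edge k)
    ; spoke-injective  = λ k l eq → spoke-injective k l (∸-cancelˡ-≡ (spoke≤N k) (spoke≤N l) eq)
    ; spoke-bounds     = λ k → ∸-monoʳ-≤ N (proj₂ (spoke-bounds k)) , ∸-monoʳ-≤ N (proj₁ (spoke-bounds k))
    ; H-periodic       = λ k → cong (N ∸_) (H-periodic k)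
    ; S-periodic       = λ k → cong (λ s → N ∸ (3 + s)) (S-periodic k)
    ; E-periodic       = λ k → cong (N ∸_) (E-periodic k)
    }
    where
    N : ℕ
    N = 3 + A
    window≤N : ∀ k → 3 + S k ≤ N
    window≤N k = +-monoʳ-≤ 3 (≤-trans (proj₁ (spoke∈window k)) (proj₂ (spoke-bounds k)))
    spoke≤N : ∀ k → H k ≤ N
    spoke≤N k = ≤-trans (proj₂ (spoke-bounds k)) (m≤n+m A 3)
    edge≤N : ∀ k → E k ≤ N
    edge≤N k = ≤-trans (proj₂ (edge∈window k)) (window≤N k)
    reflect-window : ∀ {s x} → InWindow s x → 3 + s ≤ N → InWindow (N ∸ (3 + s)) (N ∸ x)
    reflect-window {s} {x} (s≤x , x≤) le =
      ∸-monoʳ-≤ N x≤ , subst (N ∸ x ≤_) (sym (3+[n∸[3+m]]≡n∸m s N le)) (∸-monoʳ-≤ N s≤x)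
    reflect-≢ : ∀ {x y} → x ≤ N → y ≤ N → x ≢ y → N ∸ x ≢ N ∸ y
    reflect-≢ x≤N y≤N x≢y eq = x≢y (∸-cancelˡ-≡ x≤N y≤N eq)

-- The sweep: the processed vertices form an arc 0, 1, ..., i together with
-- q, ..., m - 1, all with spoke on top, whose two end spokes are M - 1 and M,
-- while every unprocessed spoke exceeds M.  The end with spoke M - 1 has its
-- outer edge below M - 1, which squeezes the next spoke to M + 1 and on top.
module Sweep {m' a A : ℕ} {H S E : ℕ → ℕ} (P : CyclicPattern (3 + m') a A H S E)
             (spoke₀ : H 0 ≡ a) (top₀ : 3 + S 0 ≡ a) where
  open CyclicPattern P

  m q₀ : ℕ
  m = 3 + m'
  q₀ = 2 + m'

  OnTop : ℕ → Set
  OnTop = SpokeOnTop S H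

  spoke-injective-< : ∀ {k l} → k < m → l < m → H k ≡ H l → k ≡ l
  spoke-injective-< k<m l<m eq =
    trans (sym (m<n⇒m%n≡m k<m)) (trans (spoke-injective _ _ eq) (m<n⇒m%n≡m l<m))

  push : ∀ j j' {e} → OnTop j → e ≤ 3 + S j → e ≢ H j → S j' ≤ e → 2 + H j ≤ H j' →
         OnTop j' × H j' ≡ 2 + H j
  push j j' on-top e≤ e≢ S≤e above =
    squeeze (≤∧≢⇒< (subst (_ ≤_) on-top e≤) e≢) S≤e (proj₂ (spoke∈window j')) above

  record Frontier (i q M : ℕ) : Set where
    field
      on-top-outside : ∀ k → k < m → k ≤ i ⊎ q ≤ k → OnTop k
      above-inside  : ∀ k → i < k → k < q → suc M ≤ H k
      ends          : (suc (H i) ≡ M × H q ≡ M) ⊎ (H i ≡ M × suc (H q) ≡ M)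

  advance-left : ∀ {i q M} → Frontier i q M → suc (H i) ≡ M → H q ≡ M → suc i < q → q < m →
                 Frontier (suc i) q (suc M)
  advance-left {i} {q} {M} F below at-q i+1<q q<m = record
    { on-top-outside = outside
    ; above-inside  = inside
    ; ends          = inj₂ (new-spoke , cong suc at-q)
    }
    where
    open Frontier F
    i+1<m : suc i < m
    i+1<m = <-trans i+1<q q<m
    new : OnTop (suc i) × H (suc i) ≡ 2 + H i
    new = push i (suc i) (on-top-outside i (<-trans (n<1+n i) i+1<m) (inj₁ ≤-refl))
            (proj₂ (edge∈window i)) (edge≢spoke i) (proj₁ (edge∈next-window i))
            (subst (_≤ H (suc i)) (cong suc (sym below)) (above-inside (suc i) (n<1+n i) i+1<q))
    new-spoke : H (suc i) ≡ suc M
    new-spoke = trans (proj₂ new) (cong suc below)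
    outside : ∀ k → k < m → k ≤ suc i ⊎ q ≤ k → OnTop k
    outside k k<m (inj₁ k≤i+1) with m≤n⇒m<n∨m≡n k≤i+1
    ... | inj₁ k<i+1 = on-top-outside k k<m (inj₁ (s≤s⁻¹ k<i+1))
    ... | inj₂ refl  = proj₁ new
    outside k k<m (inj₂ q≤k) = on-top-outside k k<m (inj₂ q≤k)
    inside : ∀ k → suc i < k → k < q → suc (suc M) ≤ H k
    inside k i+1<k k<q = ≤∧≢⇒< (above-inside k (<-trans (n<1+n i) i+1<k) k<q) λ eq →
      <-irrefl (spoke-injective-< i+1<m (<-trans k<q q<m) (trans new-spoke eq)) i+1<k

  advance-right : ∀ {i q M} → Frontier i (suc q) M → H i ≡ M → suc (H (suc q)) ≡ M → i < q → suc q < m →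
                  Frontier i q (suc M)
  advance-right {i} {q} {M} F at-i below i<q q+1<m = record
    { on-top-outside = outside
    ; above-inside  = inside
    ; ends          = inj₁ (cong suc at-i , new-spoke)
    }
    where
    open Frontier F
    q<m : q < m
    q<m = <-trans (n<1+n q) q+1<m
    new : OnTop q × H q ≡ 2 + H (suc q)
    new = push (suc q) q (on-top-outside (suc q) q+1<m (inj₂ ≤-refl))
            (proj₂ (edge∈next-window q)) (edge≢next-spoke q) (proj₁ (edge∈window q))
            (subst (_≤ H q) (cong suc (sym below)) (above-inside q i<q (n<1+n q)))
    new-spoke : H q ≡ suc M
    new-spoke = trans (proj₂ new) (cong suc below)
    outside : ∀ k → k < m → k ≤ i ⊎ q ≤ k → OnTop k
    outside k k<m (inj₁ k≤i) = on-top-outside k k<m (inj₁ k≤i)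
    outside k k<m (inj₂ q≤k) with m≤n⇒m<n∨m≡n q≤k
    ... | inj₁ q<k = on-top-outside k k<m (inj₂ q<k)
    ... | inj₂ refl = proj₁ new
    inside : ∀ k → i < k → k < q → suc (suc M) ≤ H k
    inside k i<k k<q = ≤∧≢⇒< (above-inside k i<k (<-trans k<q (n<1+n q))) λ eq →
      <-irrefl (sym (spoke-injective-< q<m (<-trans k<q q<m) (trans new-spoke eq))) k<q

  sweep : ∀ g i q M → g + suc i ≡ q → q < m → Frontier i q M → ∀ k → k < m → OnTop k
  sweep zero i .(suc i) M refl _ F k k<m with k ≤? i
  ... | yes k≤i = Frontier.on-top-outside F k k<m (inj₁ k≤i)
  ... | no  k≰i = Frontier.on-top-outside F k k<m (inj₂ (≰⇒> k≰i))
  sweep (suc g) i (suc q) M gap q<m F with Frontier.ends F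
  ... | inj₁ (below , at-q) =
    sweep g (suc i) (suc q) (suc M) (trans (+-suc g (suc i)) gap) q<m
      (advance-left F below at-q (subst (suc i <_) gap (s≤s (m≤n+m (suc i) g))) q<m)
  ... | inj₂ (at-i , below) =
    sweep g i q (suc M) (suc-injective gap) (<-trans (n<1+n q) q<m)
      (advance-right F at-i below (subst (i <_) (suc-injective gap) (m≤n+m (suc i) g)) q<m)

  above-anchor : ∀ k → 0 < k → k < m → suc a ≤ H k
  above-anchor k 0<k k<m = ≤∧≢⇒< (proj₁ (spoke-bounds k)) λ eq →
    <-irrefl (sym (spoke-injective-< k<m (s≤s z≤n) (trans (sym eq) (sym spoke₀)))) 0<k

  first-edge<a : E 0 < a
  first-edge<a = ≤∧≢⇒< (subst (E 0 ≤_) top₀ (proj₂ (edge∈window 0)))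
                       (λ eq → edge≢spoke 0 (trans eq (sym spoke₀)))

  last-edge<a : E q₀ < a
  last-edge<a = ≤∧≢⇒< (subst (E q₀ ≤_) (trans (cong (3 +_) (S-periodic 0)) top₀) (proj₂ (edge∈next-window q₀)))
                      (λ eq → edge≢next-spoke q₀ (trans eq (trans (sym spoke₀) (sym (H-periodic 0)))))

  first-edge≢last-edge : E 0 ≢ E q₀
  first-edge≢last-edge eq = edge≢next-edge q₀ (trans (sym eq) (sym (E-periodic 0)))

  Values : (u w : ℕ) → Set
  Values u w = (u ≡ suc a × w ≡ 2 + a) ⊎ (u ≡ 2 + a × w ≡ suc a)

  neighbours : OnTop 1 × OnTop q₀ × Values (H 1) (H q₀)
  neighbours with H 1 ≟ suc a
  ... | no H₁≢ =
    let ((t₁ , h₁) , (t-q , h-q)) =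
          anchor-neighbours first-edge<a last-edge<a first-edge≢last-edge
            (proj₁ (edge∈next-window 0)) (proj₂ (spoke∈window 1))
            (proj₁ (edge∈window q₀)) (proj₂ (spoke∈window q₀))
            (≤∧≢⇒< (above-anchor 1 (s≤s z≤n) (s≤s (s≤s z≤n))) (λ eq → H₁≢ (sym eq)))
            (above-anchor q₀ (s≤s z≤n) ≤-refl)
    in t₁ , t-q , inj₂ (h₁ , h-q)
  ... | yes H₁≡ =
    let ((t-q , h-q) , (t₁ , h₁)) =
          anchor-neighbours last-edge<a first-edge<a (λ eq → first-edge≢last-edge (sym eq))
            (proj₁ (edge∈window q₀)) (proj₂ (spoke∈window q₀))
            (proj₁ (edge∈next-window 0)) (proj₂ (spoke∈window 1))
            (≤∧≢⇒< (above-anchor q₀ (s≤s z≤n) ≤-refl) λ eq →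
               1≢q₀ (spoke-injective-< (s≤s (s≤s z≤n)) ≤-refl (trans H₁≡ eq)))
            (above-anchor 1 (s≤s z≤n) (s≤s (s≤s z≤n)))
    in t₁ , t-q , inj₁ (h₁ , h-q)
    where
    1≢q₀ : 1 ≢ q₀
    1≢q₀ ()

  initial : Frontier 1 q₀ (2 + a)
  initial = record
    { on-top-outside = outside
    ; above-inside  = inside
    ; ends          = ends values
    }
    where
    t₁ : OnTop 1
    t₁ = proj₁ neighbours
    t-q : OnTop q₀
    t-q = proj₁ (proj₂ neighbours)
    values : Values (H 1) (H q₀)
    values = proj₂ (proj₂ neighbours)
    ends : Values (H 1) (H q₀) → (suc (H 1) ≡ 2 + a × H q₀ ≡ 2 + a) ⊎ (H 1 ≡ 2 + a × suc (H q₀) ≡ 2 + a)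
    ends (inj₁ (h₁ , h-q)) = inj₁ (cong suc h₁ , h-q)
    ends (inj₂ (h₁ , h-q)) = inj₂ (h₁ , cong suc h-q)
    outside : ∀ k → k < m → k ≤ 1 ⊎ q₀ ≤ k → OnTop k
    outside zero          _   _                  = trans top₀ (sym spoke₀)
    outside (suc zero)    _   _                  = t₁
    outside (suc (suc k)) _   (inj₁ (s≤s ()))
    outside k             k<m (inj₂ q₀≤k) with ≤-antisym q₀≤k (s≤s⁻¹ k<m)
    ... | refl = t-q
    spoke-with-value : ∀ {v} → v ≡ suc a ⊎ v ≡ 2 + a → H 1 ≡ v ⊎ H q₀ ≡ v
    spoke-with-value {v} v∈ with values | v∈
    ... | inj₁ (h₁ , _)   | inj₁ refl = inj₁ h₁
    ... | inj₁ (_ , h-q)  | inj₂ refl = inj₂ h-q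
    ... | inj₂ (h₁ , _)   | inj₂ refl = inj₁ h₁
    ... | inj₂ (_ , h-q)  | inj₁ refl = inj₂ h-q
    inside : ∀ k → 1 < k → k < q₀ → suc (2 + a) ≤ H k
    inside k 1<k k<q₀ = ≤∧≢⇒< (≤∧≢⇒< (above-anchor k (<-trans (s≤s z≤n) 1<k) k<m) (≢spoke (inj₁ refl)))
                              (≢spoke (inj₂ refl))
      where
      k<m : k < m
      k<m = <-trans k<q₀ ≤-refl
      ≢spoke : ∀ {v} → v ≡ suc a ⊎ v ≡ 2 + a → v ≢ H k
      ≢spoke v∈ eq with spoke-with-value v∈
      ... | inj₁ h₁  = <-irrefl (spoke-injective-< (s≤s (s≤s z≤n)) k<m (trans h₁ eq)) 1<k
      ... | inj₂ h-q = <-irrefl (sym (spoke-injective-< ≤-refl k<m (trans h-q eq))) k<q₀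

  spokes-on-top-from-anchor : ∀ k → k < m → OnTop k
  spokes-on-top-from-anchor = sweep m' 1 q₀ (2 + a) (+-comm m' 2) ≤-refl initial

spokes-on-top : ∀ {m' a A H S E} → CyclicPattern (3 + m') a A H S E →
                ∀ v → 3 + S v ≡ a → H v ≡ a → ∀ k → SpokeOnTop S H k
spokes-on-top {m'} {H = H} {S} P v top spoke k =
  spoke-on-top-% P ([m+kn]%n≡m%n k v m)
    (subst (SpokeOnTop S H) (m∸n+n≡m v≤) (rotated-on-top ((k + v * m) ∸ v)))
  where
  m : ℕ
  m = 3 + m'
  v≤ : v ≤ k + v * m
  v≤ = ≤-trans (m≤m*n v m) (m≤n+m (v * m) k)
  rotated-on-top : ∀ j → SpokeOnTop (λ i → S (i + v)) (λ i → H (i + v)) j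
  rotated-on-top j = spoke-on-top-% (rotate P v) (m%n%n≡m%n j m)
    (Sweep.spokes-on-top-from-anchor (rotate P v) spoke top (j % m) (m%n<n j m))

spokes-at-bottom : ∀ {m' a A H S E} → CyclicPattern (3 + m') a A H S E →
                   ∀ v → S v ≡ A → H v ≡ A → ∀ k → S k ≡ H k
spokes-at-bottom {A = A} {H} {S} P v bottom spoke k =
  ∸-cancelˡ-≡ (≤-trans S≤H H≤N) H≤N
    (trans (sym (3+[n∸[3+m]]≡n∸m (S k) N (+-monoʳ-≤ 3 (≤-trans S≤H H≤A))))
           (spokes-on-top (reflect P) v top (cong (N ∸_) spoke) k))
  where
  open CyclicPattern P
  N : ℕ
  N = 3 + A
  S≤H : S k ≤ H k
  S≤H = proj₁ (spoke∈window k)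
  H≤A : H k ≤ A
  H≤A = proj₂ (spoke-bounds k)
  H≤N : H k ≤ N
  H≤N = ≤-trans H≤A (m≤n+m A 3)
  top : 3 + (N ∸ (3 + S v)) ≡ N ∸ A
  top = trans (cong (λ s → 3 + (N ∸ (3 + s))) bottom) (trans (cong (3 +_) (n∸n≡0 A)) (sym (m+n∸n≡m 3 A)))

countℕ-false : ∀ m → countℕ m (λ _ → false) ≡ 0
countℕ-false zero    = refl
countℕ-false (suc m) = countℕ-false m

countℕ-true : ∀ m → countℕ m (λ _ → true) ≡ m
countℕ-true zero    = refl
countℕ-true (suc m) = cong suc (countℕ-true m)

countℕ-mono : ∀ m {p q : Fin m → Bool} → (∀ i → p i ≡ true → q i ≡ true) → countℕ m p ≤ countℕ m q
countℕ-mono zero    _   = z≤n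
countℕ-mono (suc m) {p} {q} p⇒q with p fzero in p₀ | q fzero in q₀
... | true  | true  = s≤s (countℕ-mono m (λ i → p⇒q (fsuc i)))
... | true  | false with () ← trans (sym (p⇒q fzero p₀)) q₀
... | false | true  = ≤-trans (countℕ-mono m (λ i → p⇒q (fsuc i))) (n≤1+n _)
... | false | false = countℕ-mono m (λ i → p⇒q (fsuc i))

countℕ-∨ : ∀ m {p q : Fin m → Bool} → countℕ m (λ i → p i ∨ q i) ≤ countℕ m p + countℕ m q
countℕ-∨ zero = z≤n
countℕ-∨ (suc m) {p} {q} with p fzero | q fzero | countℕ-∨ m {λ i → p (fsuc i)} {λ i → q (fsuc i)}
... | true  | true  | ih = s≤s (≤-trans ih (+-monoʳ-≤ (countℕ m (λ i → p (fsuc i))) (n≤1+n _)))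
... | true  | false | ih = s≤s ih
... | false | true  | ih = subst (suc (countℕ m (λ i → p (fsuc i) ∨ q (fsuc i))) ≤_)
                               (sym (+-suc (countℕ m (λ i → p (fsuc i))) (countℕ m (λ i → q (fsuc i))))) (s≤s ih)
... | false | false | ih = ih

countℕ-≡ᵇ : ∀ m x → countℕ m (λ i → toℕ i ≡ᵇ x) ≤ 1
countℕ-≡ᵇ zero    x       = z≤n
countℕ-≡ᵇ (suc m) zero    = s≤s (≤-reflexive (countℕ-false m))
countℕ-≡ᵇ (suc m) (suc x) = countℕ-≡ᵇ m x

countℕ-≤2 : ∀ m {p : Fin m → Bool} x y → (∀ i → p i ≡ true → toℕ i ≡ x ⊎ toℕ i ≡ y) → countℕ m p ≤ 2
countℕ-≤2 m {p} x y only-x-y =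
  ≤-trans (countℕ-mono m x-or-y) (≤-trans (countℕ-∨ m) (+-mono-≤ (countℕ-≡ᵇ m x) (countℕ-≡ᵇ m y)))
  where
  x-or-y : ∀ i → p i ≡ true → ((toℕ i ≡ᵇ x) ∨ (toℕ i ≡ᵇ y)) ≡ true
  x-or-y i pi with only-x-y i pi
  ... | inj₁ i≡x = Equivalence.to T-≡ (Equivalence.from T-∨ (inj₁ (≡⇒≡ᵇ _ _ i≡x)))
  ... | inj₂ i≡y = Equivalence.to T-≡ (Equivalence.from T-∨ (inj₂ (≡⇒≡ᵇ _ _ i≡y)))

∨-swap : ∀ w x y z → w ∨ (x ∨ (y ∨ z)) ≡ x ∨ (w ∨ (z ∨ y))
∨-swap w x y z = begin
  w ∨ (x ∨ (y ∨ z))   ≡⟨ ∨-assoc w x (y ∨ z) ⟨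
  (w ∨ x) ∨ (y ∨ z)   ≡⟨ cong₂ _∨_ (∨-comm w x) (∨-comm y z) ⟩
  (x ∨ w) ∨ (z ∨ y)   ≡⟨ ∨-assoc x w (z ∨ y) ⟩
  x ∨ (w ∨ (z ∨ y))   ∎
  where open ≡-Reasoning

module Wheel (m' : ℕ) where
  n m : ℕ
  n = 4 + m'
  m = 3 + m'

  G : Graph
  G = wheel n

  hub : Fin n
  hub = fzero

  rim : ℕ → Fin n
  rim x = fsuc (x mod m)

  toℕ-mod : ∀ x → toℕ (x mod m) ≡ x % m
  toℕ-mod x = toℕ-fromℕ< (m%n<n x m)

  rim-toℕ : ∀ (z : Fin m) → rim (toℕ z) ≡ fsuc z
  rim-toℕ z = cong fsuc (trans (fromℕ<-cong _ _ (m<n⇒m%n≡m (toℕ<n z)) _ _) (fromℕ<-toℕ z (toℕ<n z)))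

  rim-periodic : ∀ x → rim (x + m) ≡ rim x
  rim-periodic x = cong fsuc (fromℕ<-cong _ _ ([m+n]%n≡m%n x m) _ _)

  rim-% : ∀ k l → rim k ≡ rim l → k % m ≡ l % m
  rim-% k l eq = trans (sym (toℕ-mod k)) (trans (cong toℕ (fsuc-injective eq)) (toℕ-mod l))

  rim-≢-2+ : ∀ x → rim x ≢ rim (2 + x)
  rim-≢-2+ x eq with %-cancelʳ-+ {m} 0 2 x (rim-% x (2 + x) eq)
  ... | ()

  adj-sym : ∀ u w → adj G u w ≡ true → adj G w u ≡ true
  adj-sym u w = trans (sym-ℕ (toℕ w) (toℕ u))
    where
    sym-ℕ : ∀ x y → wheelAdjℕ n x y ≡ wheelAdjℕ n y x
    sym-ℕ zero    zero    = refl
    sym-ℕ zero    (suc y) = refl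
    sym-ℕ (suc x) zero    = refl
    sym-ℕ (suc x) (suc y) =
      ∨-swap (y ≡ᵇ suc x) (x ≡ᵇ suc y) ((x ≡ᵇ 0) ∧ (suc y ≡ᵇ m)) ((y ≡ᵇ 0) ∧ (suc x ≡ᵇ m))

  rim-neighbour : ∀ ℓ b → wheelAdjℕ n (suc ℓ) (suc b) ≡ true →
    b ≡ suc ℓ ⊎ suc b ≡ ℓ ⊎ (ℓ ≡ 0 × suc b ≡ m) ⊎ (b ≡ 0 × suc ℓ ≡ m)
  rim-neighbour ℓ b adjacent with Equivalence.to T-∨ (Equivalence.from T-≡ adjacent)
  ... | inj₁ p = inj₁ (≡ᵇ⇒≡ b (suc ℓ) p)
  ... | inj₂ p with Equivalence.to T-∨ p
  ...   | inj₁ q = inj₂ (inj₁ (sym (≡ᵇ⇒≡ ℓ (suc b) q)))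
  ...   | inj₂ q with Equivalence.to T-∨ q
  ...     | inj₁ r = let (x , y) = Equivalence.to T-∧ r in
                     inj₂ (inj₂ (inj₁ (≡ᵇ⇒≡ ℓ 0 x , ≡ᵇ⇒≡ (suc b) m y)))
  ...     | inj₂ r = let (x , y) = Equivalence.to T-∧ r in
                     inj₂ (inj₂ (inj₂ (≡ᵇ⇒≡ b 0 x , ≡ᵇ⇒≡ (suc ℓ) m y)))

  rim-neighbours-≤2 : ∀ ℓ → countℕ m (λ j → wheelAdjℕ n (suc ℓ) (suc (toℕ j))) ≤ 2
  rim-neighbours-≤2 zero = countℕ-≤2 m 1 (2 + m') λ j adjacent →
    case (rim-neighbour 0 (toℕ j) adjacent)
    where
    case : ∀ {b} → b ≡ 1 ⊎ suc b ≡ 0 ⊎ (0 ≡ 0 × suc b ≡ m) ⊎ (b ≡ 0 × 1 ≡ m) → b ≡ 1 ⊎ b ≡ 2 + m'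
    case (inj₁ b≡1)                      = inj₁ b≡1
    case (inj₂ (inj₂ (inj₁ (_ , b+1≡m)))) = inj₂ (suc-injective b+1≡m)
  rim-neighbours-≤2 (suc ℓ) with 2 + ℓ ≟ m
  ... | yes ℓ+2≡m = countℕ-≤2 m ℓ 0 λ j adjacent → case (toℕ<n j) (rim-neighbour (suc ℓ) (toℕ j) adjacent)
    where
    case : ∀ {b} → b < m → b ≡ 2 + ℓ ⊎ suc b ≡ suc ℓ ⊎ (suc ℓ ≡ 0 × suc b ≡ m) ⊎ (b ≡ 0 × 2 + ℓ ≡ m) →
           b ≡ ℓ ⊎ b ≡ 0
    case b<m (inj₁ refl)                 = ⊥-elim (<-irrefl ℓ+2≡m b<m)
    case _   (inj₂ (inj₁ b+1≡ℓ+1))        = inj₁ (suc-injective b+1≡ℓ+1)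
    case _   (inj₂ (inj₂ (inj₂ (b≡0 , _)))) = inj₂ b≡0
  ... | no ℓ+2≢m = countℕ-≤2 m (2 + ℓ) ℓ λ j adjacent → case (rim-neighbour (suc ℓ) (toℕ j) adjacent)
    where
    case : ∀ {b} → b ≡ 2 + ℓ ⊎ suc b ≡ suc ℓ ⊎ (suc ℓ ≡ 0 × suc b ≡ m) ⊎ (b ≡ 0 × 2 + ℓ ≡ m) →
           b ≡ 2 + ℓ ⊎ b ≡ ℓ
    case (inj₁ b≡ℓ+2)                    = inj₁ b≡ℓ+2
    case (inj₂ (inj₁ b+1≡ℓ+1))           = inj₂ (suc-injective b+1≡ℓ+1)
    case (inj₂ (inj₂ (inj₂ (_ , ℓ+2≡m)))) = ⊥-elim (ℓ+2≢m ℓ+2≡m)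

  deg-rim : ∀ (z : Fin m) → deg G (fsuc z) ≤ 3
  deg-rim z = s≤s (rim-neighbours-≤2 (toℕ z))

  deg-hub : deg G hub ≡ m
  deg-hub = countℕ-true m

  suc-% : ∀ x → suc x % m ≡ suc (x % m) ⊎ (suc x % m ≡ 0 × suc (x % m) ≡ m)
  suc-% x with suc (x % m) <? m
  ... | yes x%m+1<m = inj₁ (trans (%-distribˡ-+ 1 x m) (m<n⇒m%n≡m x%m+1<m))
  ... | no  x%m+1≮m = inj₂ (trans (%-distribˡ-+ 1 x m) (trans (cong (_% m) wraps) (n%n≡0 m)) , wraps)
    where
    wraps : suc (x % m) ≡ m
    wraps = ≤-antisym (m%n<n x m) (≮⇒≥ x%m+1≮m)

  rim-adjacent : ∀ x → adj G (rim x) (rim (suc x)) ≡ true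
  rim-adjacent x =
    subst₂ (λ ℓ b → wheelAdjℕ n (suc ℓ) (suc b) ≡ true) (sym (toℕ-mod x)) (sym (toℕ-mod (suc x)))
      (step (suc-% x))
    where
    step : ∀ {ℓ b} → b ≡ suc ℓ ⊎ (b ≡ 0 × suc ℓ ≡ m) → wheelAdjℕ n (suc ℓ) (suc b) ≡ true
    step {ℓ} (inj₁ refl)           = Equivalence.to T-≡ (Equivalence.from T-∨ (inj₁ (≡⇒≡ᵇ ℓ ℓ refl)))
    step     (inj₂ (refl , refl)) = Equivalence.to T-≡ (≡⇒≡ᵇ m' m' refl)

module Coloring {m' t : ℕ} (C : IntervalTotalColoring (wheel (4 + m')) t) where
  open Wheel m'
  open IntervalTotalColoring C

  ColorAt : Fin n → ℕ → Set
  ColorAt w k = k ≡ c w ⊎ ∃ λ w' → adj G w w' ≡ true × f w w' ≡ k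

  start : Fin n → ℕ
  start w = proj₁ (interval w)

  color-range : ∀ w {k} → ColorAt w k → start w ≤ k × k ≤ start w + deg G w
  color-range w {k} = proj₁ (proj₂ (interval w) k)

  a : ℕ
  a = start hub

  hub-colors : ∀ {k} → ColorAt hub k → a ≤ k × k ≤ a + m
  hub-colors {k} p = subst (λ d → a ≤ k × k ≤ a + d) deg-hub (color-range hub p)

  rim-colors : ∀ z {k} → ColorAt (fsuc z) k → InWindow (start (fsuc z)) k
  rim-colors z p = let (lo , hi) = color-range (fsuc z) p in
    lo , ≤-trans hi (≤-trans (+-monoʳ-≤ (start (fsuc z)) (deg-rim z)) (≤-reflexive (+-comm (start (fsuc z)) 3)))

  edge-colorˡ : ∀ {x y} → adj G x y ≡ true → ColorAt x (f x y)
  edge-colorˡ {y = y} xy = inj₂ (y , xy , refl)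

  edge-colorʳ : ∀ {x y} → adj G x y ≡ true → ColorAt y (f x y)
  edge-colorʳ {x} {y} xy = inj₂ (x , adj-sym x y xy , sym (f-sym x y xy))

  used : ∀ i → 1 ≤ i → i ≤ t → ∃ λ w → ColorAt w i
  used i 1≤i i≤t with surj i 1≤i i≤t
  ... | inj₁ (x , cx≡i) = x , inj₁ (sym cx≡i)
  ... | inj₂ (x , y , xy , fxy≡i) = x , inj₂ (y , xy , fxy≡i)

  spoke rim-start rim-edge : ℕ → ℕ
  spoke x = f (rim x) hub
  rim-start x = start (rim x)
  rim-edge x = f (rim x) (rim (suc x))

  rim-window : ∀ z {k} → ColorAt (fsuc z) k → InWindow (rim-start (toℕ z)) k
  rim-window z {k} p = rim-colors _ (subst (λ w → ColorAt w k) (sym (rim-toℕ z)) p)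

  rim-pattern : CyclicPattern m a (a + m) spoke rim-start rim-edge
  rim-pattern = record
    { spoke∈window     = λ x → rim-colors _ (edge-colorˡ refl)
    ; edge∈window      = λ x → rim-colors _ (edge-colorˡ (rim-adjacent x))
    ; edge∈next-window = λ x → rim-colors _ (edge-colorʳ (rim-adjacent x))
    ; edge≢spoke       = λ x → ee-proper (rim x) (rim (suc x)) hub (rim-adjacent x) refl (λ ())
    ; edge≢next-spoke  = λ x eq → ee-proper (rim (suc x)) (rim x) hub (rim-adjacent⁻ x) refl (λ ())
                                    (trans (sym (rim-edge-sym x)) eq)
    ; edge≢next-edge   = λ x eq → ee-proper (rim (suc x)) (rim x) (rim (suc (suc x)))
                                    (rim-adjacent⁻ x) (rim-adjacent (suc x)) (rim-≢-2+ x)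
                                    (trans (sym (rim-edge-sym x)) eq)
    ; spoke-injective  = spoke-injective
    ; spoke-bounds     = λ x → hub-colors (edge-colorʳ refl)
    ; H-periodic       = λ x → cong (λ w → f w hub) (rim-periodic x)
    ; S-periodic       = λ x → cong start (rim-periodic x)
    ; E-periodic       = λ x → cong₂ f (rim-periodic x) (rim-periodic (suc x))
    }
    where
    rim-adjacent⁻ : ∀ x → adj G (rim (suc x)) (rim x) ≡ true
    rim-adjacent⁻ x = adj-sym (rim x) (rim (suc x)) (rim-adjacent x)
    rim-edge-sym : ∀ x → f (rim x) (rim (suc x)) ≡ f (rim (suc x)) (rim x)
    rim-edge-sym x = f-sym (rim x) (rim (suc x)) (rim-adjacent x)
    spoke-injective : ∀ k l → spoke k ≡ spoke l → k % m ≡ l % m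
    spoke-injective k l eq with rim k ≟ᶠ rim l
    ... | yes rims≡ = rim-% k l rims≡
    ... | no  rims≢ = ⊥-elim (ee-proper hub (rim k) (rim l) refl refl rims≢
                         (trans (f-sym hub (rim k) refl) (trans eq (sym (f-sym hub (rim l) refl)))))

  colors-≤-top : ∀ v → 3 + rim-start v ≡ a → spoke v ≡ a → ∀ w {k} → ColorAt w k → k ≤ a + m
  colors-≤-top v top at-a fzero     p = proj₂ (hub-colors p)
  colors-≤-top v top at-a (fsuc z)  p =
    ≤-trans (proj₂ (rim-window z p))
      (≤-trans (≤-reflexive (spokes-on-top rim-pattern v top at-a (toℕ z)))
               (proj₂ (CyclicPattern.spoke-bounds rim-pattern (toℕ z))))

  colors-≥-bottom : ∀ v → rim-start v ≡ a + m → spoke v ≡ a + m → ∀ w {k} → ColorAt w k → a ≤ k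
  colors-≥-bottom v bottom at-A fzero    p = proj₁ (hub-colors p)
  colors-≥-bottom v bottom at-A (fsuc z) p =
    ≤-trans (proj₁ (CyclicPattern.spoke-bounds rim-pattern (toℕ z)))
      (≤-trans (≤-reflexive (sym (spokes-at-bottom rim-pattern v bottom at-A (toℕ z))))
               (proj₁ (rim-window z p)))

  small-hub-start : a ≤ 3 → 6 + m ≤ t → ⊥
  small-hub-start a≤3 6+m≤t with used t (≤-trans (s≤s z≤n) 6+m≤t) ≤-refl
  ... | fzero , p = ≤⇒≯ (proj₂ (hub-colors p)) (begin-strict
    a + m  ≤⟨ +-monoˡ-≤ m a≤3 ⟩
    3 + m  <⟨ m≤n+m (4 + m) 2 ⟩
    6 + m  ≤⟨ 6+m≤t ⟩
    t      ∎)
    where open ≤-Reasoning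
  ... | fsuc z , p = 3≰1 (≤-trans 3≤a (colors-≥-bottom v bottom at-A (proj₁ one) (proj₂ one)))
    where
    open CyclicPattern rim-pattern using (spoke∈window; spoke-bounds)
    v : ℕ
    v = toℕ z
    t≤ : t ≤ 3 + rim-start v
    t≤ = proj₂ (rim-window z p)
    A≤start : a + m ≤ rim-start v
    A≤start = +-cancelˡ-≤ 3 _ _ (≤-trans (+-monoʳ-≤ 3 (+-monoˡ-≤ m a≤3)) (≤-trans 6+m≤t t≤))
    bottom : rim-start v ≡ a + m
    bottom = ≤-antisym (≤-trans (proj₁ (spoke∈window v)) (proj₂ (spoke-bounds v))) A≤start
    at-A : spoke v ≡ a + m
    at-A = ≤-antisym (proj₂ (spoke-bounds v)) (≤-trans A≤start (proj₁ (spoke∈window v)))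
    3≤a : 3 ≤ a
    3≤a = +-cancelʳ-≤ m 3 a (+-cancelˡ-≤ 3 _ _ (≤-trans 6+m≤t (subst (λ s → t ≤ 3 + s) bottom t≤)))
    one : ∃ λ w → ColorAt w 1
    one = used 1 (s≤s z≤n) (≤-trans (s≤s z≤n) 6+m≤t)
    3≰1 : ¬ 3 ≤ 1
    3≰1 (s≤s ())

  large-hub-start : 4 ≤ a → 6 + m ≤ t → ⊥
  large-hub-start 4≤a 6+m≤t with used 1 (s≤s z≤n) (≤-trans (s≤s z≤n) 6+m≤t)
  ... | fzero , p = 4≰1 (≤-trans 4≤a (proj₁ (hub-colors p)))
    where
    4≰1 : ¬ 4 ≤ 1
    4≰1 (s≤s ())
  ... | fsuc z , p = ≤⇒≯ (colors-≤-top v top at-a (proj₁ highest) (proj₂ highest)) (begin-strict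
    a + m  ≤⟨ +-monoˡ-≤ m (≤-trans (≤-reflexive (sym top)) window-top) ⟩
    4 + m  <⟨ m≤n+m (5 + m) 1 ⟩
    6 + m  ≤⟨ 6+m≤t ⟩
    t      ∎)
    where
    open ≤-Reasoning
    open CyclicPattern rim-pattern using (spoke∈window; spoke-bounds)
    v : ℕ
    v = toℕ z
    window-top : 3 + rim-start v ≤ 4
    window-top = +-monoʳ-≤ 3 (proj₁ (rim-window z p))
    at-a : spoke v ≡ a
    at-a = ≤-antisym (≤-trans (proj₂ (spoke∈window v)) (≤-trans window-top 4≤a)) (proj₁ (spoke-bounds v))
    top : 3 + rim-start v ≡ a
    top = ≤-antisym (≤-trans window-top 4≤a) (≤-trans (proj₁ (spoke-bounds v)) (proj₂ (spoke∈window v)))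
    highest : ∃ λ w → ColorAt w t
    highest = used t (≤-trans (s≤s z≤n) 6+m≤t) ≤-refl

  no-coloring : 6 + m ≤ t → ⊥
  no-coloring 6+m≤t with a ≤? 3
  ... | yes a≤3 = small-hub-start a≤3 6+m≤t
  ... | no  a≰3 = large-hub-start (≰⇒> a≰3) 6+m≤t

lemma5 : ∀ (n : ℕ) → 4 ≤ n → ∀ (t : ℕ) → n + 5 ≤ t → ¬ IntervalTotalColoring (wheel n) t
lemma5 (suc (suc (suc (suc m')))) (s≤s (s≤s (s≤s (s≤s z≤n)))) t n+5≤t C =
  Coloring.no-coloring C (subst (_≤ t) (cong (4 +_) (+-comm m' 5)) n+5≤t)
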